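{- Let $m\geq 2$ and $n\geq 1$, and let $T$ be the $(m-1)\times n$ tableau with entries $T_{ij}=(j-1)(m-1)+i$ for $(i,j)\in[m-1]\times[n]$. Then $T$ is realizable and has at least $C_n=\frac{1}{n+1}\binom{2n}{n}$ (the $n$-th Catalan number) distinct single-row extensions.
   Context: An $a\times n$ standard Young tableau is a bijection $[a]\times[n]\to\{1,\dots,an\}$ increasing along rows and columns; row $i$ is $\{i\}\times[n]$, the bottom row is row $a$. A vector is increasing if its coordinates are strictly increasing. For increasing $x\in\mathbb{R}^a$, $y\in\mathbb{R}^n$ with the numbers $x_i+y_j$ pairwise distinct, $\mathcal T(x\circ y)$ is the tableau whose $(i,j)$ entry is the rank of $x_i+y_j$ among these numbers (rank $1$ = smallest). A tableau is realizable if it equals some $\mathcal T(x\circ y)$; $\mathrm{rSYT}(a,n)$ denotes the realizable $a\times n$ tableaux. Given $T\in\mathrm{rSYT}(m-1,n)$, a single-row extension of $T$ is a $T'\in\mathrm{rSYT}(m,n)$ such that, after deleting the bottom row of $T'$, the relative order of the remaining entries is the same as in $T$. -}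

module Defs where

open import Data.Nat as ℕ using (ℕ; zero; suc; _*_; _/_)
open import Data.Nat.Combinatorics using (_C_)
open import Data.Fin as Fin using (Fin; toℕ; inject₁)
open import Data.Rational as ℚ using (ℚ)
open import Data.Rational.Properties using (_<?_)
open import Data.Product using (Σ; _×_; _,_)
open import Relation.Nullary using (¬_)
open import Relation.Nullary.Decidable using (⌊_⌋)
open import Data.Bool using (if_then_else_)
open import Relation.Binary.PropositionalEquality using (_≡_)
open import Function.Bundles using (_⇔_)

-- An a × n array of natural numbers; (i , j) is 0-indexed (row i, column j).
Tableau : ℕ → ℕ → Set
Tableau a n = Fin a → Fin n → ℕ

sumFin : ∀ {n} → (Fin n → ℕ) → ℕ
sumFin {zero}  f = 0
sumFin {suc n} f = f Fin.zero ℕ.+ sumFin (λ i → f (Fin.suc i))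

Increasing : ∀ {a} → (Fin a → ℚ) → Set
Increasing x = ∀ i j → i Fin.< j → x i ℚ.< x j

DistinctSums : ∀ {a n} → (Fin a → ℚ) → (Fin n → ℚ) → Set
DistinctSums {a} {n} x y =
  ∀ (i k : Fin a) (j l : Fin n) → ¬ ((i , j) ≡ (k , l)) → ¬ (x i ℚ.+ y j ≡ x k ℚ.+ y l)

rank : ∀ {a n} → (Fin a → ℚ) → (Fin n → ℚ) → ℚ → ℕ
rank x y s = suc (sumFin (λ k → sumFin (λ l →
               if ⌊ x k ℚ.+ y l <? s ⌋ then 1 else 0)))

𝒯 : ∀ {a n} → (Fin a → ℚ) → (Fin n → ℚ) → Tableau a n
𝒯 x y i j = rank x y (x i ℚ.+ y j)

Realizable : ∀ a n → Tableau a n → Set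
Realizable a n T =
  Σ (Fin a → ℚ) λ x → Σ (Fin n → ℚ) λ y →
    Increasing x × Increasing y × DistinctSums x y × (∀ i j → T i j ≡ 𝒯 x y i j)

SingleRowExtension : ∀ k n → Tableau k n → Tableau (suc k) n → Set
SingleRowExtension k n T T' =
  Realizable (suc k) n T' ×
  (∀ (i i' : Fin k) (j j' : Fin n) →
     (T' (inject₁ i) j ℕ.< T' (inject₁ i') j') ⇔ (T i j ℕ.< T i' j'))

_≐_ : ∀ {a n} → Tableau a n → Tableau a n → Set
T ≐ U = ∀ i j → T i j ≡ U i j

catalan : ℕ → ℕ
catalan n = ((2 * n) C n) / suc n

-- the (m-1) × n tableau T_{ij} = (j-1)(m-1) + i (1-indexed), with k = m - 1
staircaseT : ∀ k n → Tableau k n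
staircaseT k n i j = toℕ j * k ℕ.+ toℕ i ℕ.+ 1

{-# OPTIONS --safe #-}
-- The staircase is realized by x_i = i, y_j = jk, whose sums are exactly 0, …, nk − 1.
-- To extend it, give column j the level Y_j and the new bottom row the extra level D, and
-- encode (level, row) as row + level·(k + 1): entries then compare lexicographically, so
-- the old rows keep the staircase order, while the bottom entry of column j exceeds the
-- top entry of column l iff D + Y_j > Y_l.  For every ballot sequence g (nondecreasing,
-- g(l) ≤ l) one builds D and increasing Y column by column so that the bottom entries
-- below column l are exactly those of the columns j < g(l); the tableau therefore
-- determines g.  There are C(2n, n) − C(2n, n − 1) = C_n ballot sequences of length n.
module Submission where

open import Defs
open import Data.Nat using (ℕ; suc; _≤_)
open import Data.Fin using (Fin)
open import Data.Product using (Σ; _×_)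
open import Relation.Binary.PropositionalEquality using (_≡_)

open import Data.Bool using (if_then_else_)
open import Data.Fin as Fin using (toℕ; inject₁; fromℕ; fromℕ<; splitAt)
import Data.Fin.Properties as Fin
open import Data.Fin.Relation.Unary.Top using (view; ‵fromℕ; ‵inject₁; view-fromℕ; view-inject₁)
import Data.Integer as ℤ
import Data.Integer.Properties as ℤ
open import Data.Nat as ℕ
  using (zero; _+_; _*_; _∸_; _^_; _!; _⊓_; _⊔_; _<_; _≤?_; _<?_; z≤n; s≤s; s≤s⁻¹; pred; NonZero)
open import Data.Nat.Combinatorics
  using ( _C_; nCk+nC[k+1]≡[n+1]C[k+1]; nCk≡nC[n∸k]; nCk≡n!/k![n-k]!; k![n∸k]!∣n!
        ; [n-k]*d[k+1]≡[k+1]*d[k])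
open import Data.Nat.Coprimality as Coprime using (1-coprimeTo)
open import Data.Nat.DivMod using (_/_; m/n*n≡m; m*n/n≡m)
open import Data.Nat.Properties
open import Algebra.Properties.CommutativeSemigroup *-commutativeSemigroup using (x∙yz≈y∙xz)
open import Algebra.Properties.CommutativeSemigroup +-commutativeSemigroup
  using () renaming (interchange to +-interchange)
import Algebra.Properties.CommutativeMonoid.Sum +-0-commutativeMonoid as ∑
open import Data.Product using (_,_)
open import Data.Product.Relation.Binary.Lex.Strict using (×-Lex)
open import Data.Rational as ℚ using (ℚ; mkℚ)
import Data.Rational.Properties as ℚ
import Data.Rational.Unnormalised as ℚᵘ
open import Data.Rational.Unnormalised.Properties using (≃-trans)
open import Data.Sum using (_⊎_; inj₁; inj₂; [_,_]′)
open import Data.Vec.Functional using (_++_)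
open import Function using (_∘_; _⇔_; mk⇔; Equivalence)
open import Function.Construct.Symmetry using (⇔-sym)
open import Function.Related.Propositional using (module EquationalReasoning)
open import Relation.Binary using (Rel; _Preserves_⟶_; tri<; tri≈; tri>)
open import Relation.Binary.PropositionalEquality
  using (refl; sym; trans; cong; cong₂; subst; subst₂; module ≡-Reasoning)
open import Relation.Nullary using (¬_; Dec; yes; no; contradiction)
open import Relation.Nullary.Decidable using (⌊_⌋)

ι : ℕ → ℚ
ι n = mkℚ (ℤ.+ n) 0 (Coprime.sym (1-coprimeTo n))

ι-+ : ∀ m n → ι m ℚ.+ ι n ≡ ι (m + n)
ι-+ m n = ℚ.toℚᵘ-injective (≃-trans (ℚ.toℚᵘ-homo-+ (ι m) (ι n)) (ℚᵘ.*≡* (begin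
  (ℤ.+ m ℤ.* ℤ.+ 1 ℤ.+ ℤ.+ n ℤ.* ℤ.+ 1) ℤ.* ℤ.+ 1  ≡⟨ ℤ.*-identityʳ _ ⟩
  ℤ.+ m ℤ.* ℤ.+ 1 ℤ.+ ℤ.+ n ℤ.* ℤ.+ 1              ≡⟨ cong₂ ℤ._+_ (ℤ.*-identityʳ (ℤ.+ m))
                                                                   (ℤ.*-identityʳ (ℤ.+ n)) ⟩
  ℤ.+ m ℤ.+ ℤ.+ n                                  ≡⟨ ℤ.pos-+ m n ⟨
  ℤ.+ (m + n)                                      ≡⟨ ℤ.*-identityʳ _ ⟨
  ℤ.+ (m + n) ℤ.* ℤ.+ 1                            ∎)))
  where open ≡-Reasoning

ι-mono-< : ∀ {m n} → m < n → ι m ℚ.< ι n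
ι-mono-< {m} {n} m<n =
  ℚ.*<* (subst₂ ℤ._<_ (sym (ℤ.*-identityʳ (ℤ.+ m))) (sym (ℤ.*-identityʳ (ℤ.+ n))) (ℤ.+<+ m<n))

ι-cancel-< : ∀ {m n} → ι m ℚ.< ι n → m < n
ι-cancel-< {m} {n} (ℚ.*<* p) =
  ℤ.drop‿+<+ (subst₂ ℤ._<_ (ℤ.*-identityʳ (ℤ.+ m)) (ℤ.*-identityʳ (ℤ.+ n)) p)

ι-injective : ∀ {m n} → ι m ≡ ι n → m ≡ n
ι-injective refl = refl

sumFin-cong : ∀ {n} {f g : Fin n → ℕ} → (∀ i → f i ≡ g i) → sumFin f ≡ sumFin g
sumFin-cong {zero}  f≗g = refl
sumFin-cong {suc n} f≗g = cong₂ _+_ (f≗g Fin.zero) (sumFin-cong (f≗g ∘ Fin.suc))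

sumFin-mono-≤ : ∀ {n} {f g : Fin n → ℕ} → (∀ i → f i ≤ g i) → sumFin f ≤ sumFin g
sumFin-mono-≤ {zero}  f≤g = z≤n
sumFin-mono-≤ {suc n} f≤g = +-mono-≤ (f≤g Fin.zero) (sumFin-mono-≤ (f≤g ∘ Fin.suc))

sumFin-mono-< : ∀ {n} {f g : Fin n → ℕ} → (∀ i → f i ≤ g i) → ∀ i → f i < g i → sumFin f < sumFin g
sumFin-mono-< {suc n} f≤g Fin.zero    f<g = +-mono-<-≤ f<g (sumFin-mono-≤ (f≤g ∘ Fin.suc))
sumFin-mono-< {suc n} f≤g (Fin.suc i) f<g =
  +-mono-≤-< (f≤g Fin.zero) (sumFin-mono-< (f≤g ∘ Fin.suc) i f<g)

sumFin≡sum : ∀ {n} (f : Fin n → ℕ) → sumFin f ≡ ∑.sum f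
sumFin≡sum {zero}  f = refl
sumFin≡sum {suc n} f = cong (_+_ (f Fin.zero)) (sumFin≡sum (f ∘ Fin.suc))

sumFin-comm : ∀ {m n} (f : Fin m → Fin n → ℕ) →
              sumFin (λ i → sumFin (f i)) ≡ sumFin (λ j → sumFin (λ i → f i j))
sumFin-comm f = begin
  sumFin (λ i → sumFin (f i))          ≡⟨ sumFin-cong (sumFin≡sum ∘ f) ⟩
  sumFin (λ i → ∑.sum (f i))           ≡⟨ sumFin≡sum (λ i → ∑.sum (f i)) ⟩
  ∑.sum (λ i → ∑.sum (f i))            ≡⟨ ∑.∑-comm f ⟩
  ∑.sum (λ j → ∑.sum (λ i → f i j))    ≡⟨ sumFin≡sum (λ j → ∑.sum (λ i → f i j)) ⟨
  sumFin (λ j → ∑.sum (λ i → f i j))   ≡⟨ sumFin-cong (λ j → sumFin≡sum (λ i → f i j)) ⟨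
  sumFin (λ j → sumFin (λ i → f i j))  ∎
  where open ≡-Reasoning

𝟙[_<_] : ℚ → ℚ → ℕ
𝟙[ p < q ] = if ⌊ p ℚ.<? q ⌋ then 1 else 0

𝟙-true : ∀ {p q} → p ℚ.< q → 𝟙[ p < q ] ≡ 1
𝟙-true {p} {q} p<q with p ℚ.<? q
... | yes _   = refl
... | no  p≮q = contradiction p<q p≮q

𝟙-false : ∀ {p q} → ¬ p ℚ.< q → 𝟙[ p < q ] ≡ 0
𝟙-false {p} {q} p≮q with p ℚ.<? q
... | yes p<q = contradiction p<q p≮q
... | no  _   = refl

𝟙-mono : ∀ p {q r} → q ℚ.≤ r → 𝟙[ p < q ] ≤ 𝟙[ p < r ]
𝟙-mono p {q} {r} q≤r with p ℚ.<? q | p ℚ.<? r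
... | no  _   | _       = z≤n
... | yes _   | yes _   = ≤-refl
... | yes p<q | no  p≮r = contradiction (ℚ.<-≤-trans p<q q≤r) p≮r

module _ {a n} (x : Fin a → ℚ) (y : Fin n → ℚ) where

  rank-mono-< : ∀ i j {s} → x i ℚ.+ y j ℚ.< s → rank x y (x i ℚ.+ y j) < rank x y s
  rank-mono-< i j {s} t<s =
    s≤s (sumFin-mono-< (λ k → sumFin-mono-≤ λ l → 𝟙-mono (x k ℚ.+ y l) (ℚ.<⇒≤ t<s)) i
          (sumFin-mono-< (λ l → 𝟙-mono (x i ℚ.+ y l) (ℚ.<⇒≤ t<s)) j 𝟙[t<t]<𝟙[t<s]))
    where
    𝟙[t<t]<𝟙[t<s] : 𝟙[ x i ℚ.+ y j < x i ℚ.+ y j ] < 𝟙[ x i ℚ.+ y j < s ]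
    𝟙[t<t]<𝟙[t<s] = subst₂ _<_ (sym (𝟙-false (ℚ.<-irrefl refl))) (sym (𝟙-true t<s)) ≤-refl

  𝒯-<⇔ : ∀ i j i' j' → 𝒯 x y i j < 𝒯 x y i' j' ⇔ x i ℚ.+ y j ℚ.< x i' ℚ.+ y j'
  𝒯-<⇔ i j i' j' = mk⇔ to (rank-mono-< i j)
    where
    to : 𝒯 x y i j < 𝒯 x y i' j' → x i ℚ.+ y j ℚ.< x i' ℚ.+ y j'
    to 𝒯< with ℚ.<-cmp (x i ℚ.+ y j) (x i' ℚ.+ y j')
    ... | tri< t<t' _ _ = t<t'
    ... | tri≈ _ t≡t' _ = contradiction (cong (rank x y) t≡t') (<⇒≢ 𝒯<)
    ... | tri> _ _ t>t' = contradiction (rank-mono-< i' j' t>t') (<-asym 𝒯<)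

module _ {a n} (X : Fin a → ℕ) (Y : Fin n → ℕ) where

  𝒯-ι-<⇔ : ∀ i j i' j' → 𝒯 (ι ∘ X) (ι ∘ Y) i j < 𝒯 (ι ∘ X) (ι ∘ Y) i' j' ⇔ X i + Y j < X i' + Y j'
  𝒯-ι-<⇔ i j i' j' = mk⇔
    (λ 𝒯< → ι-cancel-< (subst₂ ℚ._<_ (ι-+ (X i) (Y j)) (ι-+ (X i') (Y j')) (to 𝒯<)))
    (λ t<t' → from (subst₂ ℚ._<_ (sym (ι-+ (X i) (Y j))) (sym (ι-+ (X i') (Y j'))) (ι-mono-< t<t')))
    where open Equivalence (𝒯-<⇔ (ι ∘ X) (ι ∘ Y) i j i' j')

  realizable-ι : ∀ {T : Tableau a n} →
                 X Preserves Fin._<_ ⟶ _<_ → Y Preserves Fin._<_ ⟶ _<_ →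
                 (∀ i i' j j' → X i + Y j ≡ X i' + Y j' → (i , j) ≡ (i' , j')) →
                 (∀ i j → T i j ≡ 𝒯 (ι ∘ X) (ι ∘ Y) i j) → Realizable a n T
  realizable-ι X-mono Y-mono sums-injective T≐𝒯 =
    ι ∘ X , ι ∘ Y , (λ _ _ → ι-mono-< ∘ X-mono) , (λ _ _ → ι-mono-< ∘ Y-mono) , distinct , T≐𝒯
    where
    distinct : DistinctSums (ι ∘ X) (ι ∘ Y)
    distinct i i' j j' ij≢i'j' t≡t' = ij≢i'j' (sums-injective i i' j j'
      (ι-injective (trans (sym (ι-+ (X i) (Y j))) (trans t≡t' (ι-+ (X i') (Y j'))))))

-- Lexicographic encoding of pairs

_<ₗₑₓ_ : ℕ × ℕ → ℕ × ℕ → Set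
_<ₗₑₓ_ = ×-Lex _≡_ _<_ _<_

module _ {q : ℕ} where

  +*-mono-<ₗₑₓ : ∀ {A B r r'} → r < q → (A , r) <ₗₑₓ (B , r') → r + A * q < r' + B * q
  +*-mono-<ₗₑₓ {A} {B} {r} {r'} r<q (inj₁ A<B) = begin-strict
    r + A * q   <⟨ +-monoˡ-< (A * q) r<q ⟩
    suc A * q   ≤⟨ *-monoˡ-≤ q A<B ⟩
    B * q       ≤⟨ m≤n+m (B * q) r' ⟩
    r' + B * q  ∎
    where open ≤-Reasoning
  +*-mono-<ₗₑₓ {A} r<q (inj₂ (refl , r<r')) = +-monoˡ-< (A * q) r<r'

  +*-<⇔<ₗₑₓ : ∀ {A B r r'} → r < q → r' < q → r + A * q < r' + B * q ⇔ (A , r) <ₗₑₓ (B , r')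
  +*-<⇔<ₗₑₓ {A} {B} {r} {r'} r<q r'<q = mk⇔ to (+*-mono-<ₗₑₓ r<q)
    where
    to : r + A * q < r' + B * q → (A , r) <ₗₑₓ (B , r')
    to t<t' with <-cmp A B
    ... | tri< A<B _ _  = inj₁ A<B
    ... | tri≈ _ refl _ = inj₂ (refl , +-cancelʳ-< (A * q) r r' t<t')
    ... | tri> _ _ B<A  = contradiction (+*-mono-<ₗₑₓ r'<q (inj₁ B<A)) (<-asym t<t')

  +*-injective : ∀ {A B r r'} → r < q → r' < q → r + A * q ≡ r' + B * q → r ≡ r' × A ≡ B
  +*-injective {A} {B} {r} {r'} r<q r'<q t≡t' with <-cmp A B
  ... | tri< A<B _ _  = contradiction t≡t' (<⇒≢ (+*-mono-<ₗₑₓ r<q (inj₁ A<B)))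
  ... | tri≈ _ refl _ = +-cancelʳ-≡ (A * q) r r' t≡t' , refl
  ... | tri> _ _ B<A  = contradiction (sym t≡t') (<⇒≢ (+*-mono-<ₗₑₓ r'<q (inj₁ B<A)))

module _ {n} {f : Fin n → ℕ} (f-mono : f Preserves Fin._<_ ⟶ _<_) where

  mono-cancel-< : ∀ {i j} → f i < f j → i Fin.< j
  mono-cancel-< {i} {j} fi<fj with Fin.<-cmp i j
  ... | tri< i<j _ _  = i<j
  ... | tri≈ _ refl _ = contradiction fi<fj (<-irrefl refl)
  ... | tri> _ _ j<i  = contradiction (f-mono j<i) (<-asym fi<fj)

  mono-injective : ∀ {i j} → f i ≡ f j → i ≡ j
  mono-injective {i} {j} fi≡fj with Fin.<-cmp i j
  ... | tri< i<j _ _ = contradiction fi≡fj (<⇒≢ (f-mono i<j))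
  ... | tri≈ _ i≡j _ = i≡j
  ... | tri> _ _ j<i = contradiction (sym fi≡fj) (<⇒≢ (f-mono j<i))

  <ₗₑₓ-reindex : ∀ {i j r r'} → (f i , r) <ₗₑₓ (f j , r') ⇔ (toℕ i , r) <ₗₑₓ (toℕ j , r')
  <ₗₑₓ-reindex = mk⇔
    (λ { (inj₁ fi<fj)          → inj₁ (mono-cancel-< fi<fj)
       ; (inj₂ (fi≡fj , r<r')) → inj₂ (cong toℕ (mono-injective fi≡fj) , r<r') })
    (λ { (inj₁ i<j)            → inj₁ (f-mono i<j)
       ; (inj₂ (i≡j , r<r'))   → inj₂ (cong f (Fin.toℕ-injective i≡j) , r<r') })

-- The staircase tableau

m⊓n+[m∸n]⊓o≡m⊓[n+o] : ∀ m n o → m ⊓ n + (m ∸ n) ⊓ o ≡ m ⊓ (n + o)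
m⊓n+[m∸n]⊓o≡m⊓[n+o] m       zero    o = cong (_+ m ⊓ o) (⊓-zeroʳ m)
m⊓n+[m∸n]⊓o≡m⊓[n+o] zero    (suc n) o = refl
m⊓n+[m∸n]⊓o≡m⊓[n+o] (suc m) (suc n) o = cong suc (m⊓n+[m∸n]⊓o≡m⊓[n+o] m n o)

column-count : ∀ k c s → sumFin {k} (λ i → 𝟙[ ι (toℕ i + c) < ι s ]) ≡ (s ∸ c) ⊓ k
column-count zero    c s = sym (⊓-zeroʳ (s ∸ c))
column-count (suc k) c s = begin
  𝟙[ ι c < ι s ] + sumFin {k} (λ i → 𝟙[ ι (suc (toℕ i) + c) < ι s ])
    ≡⟨ cong (𝟙[ ι c < ι s ] +_) (sumFin-cong {k} λ i →
         cong (λ m → 𝟙[ ι m < ι s ]) (sym (+-suc (toℕ i) c))) ⟩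
  𝟙[ ι c < ι s ] + sumFin {k} (λ i → 𝟙[ ι (toℕ i + suc c) < ι s ])
    ≡⟨ cong (𝟙[ ι c < ι s ] +_) (column-count k (suc c) s) ⟩
  𝟙[ ι c < ι s ] + (s ∸ suc c) ⊓ k
    ≡⟨ first-row (c <? s) ⟩
  (s ∸ c) ⊓ suc k ∎
  where
  open ≡-Reasoning
  first-row : Dec (c < s) → 𝟙[ ι c < ι s ] + (s ∸ suc c) ⊓ k ≡ (s ∸ c) ⊓ suc k
  first-row (yes c<s) rewrite 𝟙-true (ι-mono-< c<s) | +-∸-assoc 1 c<s = refl
  first-row (no c≮s)  rewrite 𝟙-false (c≮s ∘ ι-cancel-<) | m≤n⇒m∸n≡0 (≮⇒≥ c≮s)
                            | m≤n⇒m∸n≡0 (m≤n⇒m≤1+n (≮⇒≥ c≮s)) = refl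

grid-count : ∀ n k s → sumFin {n} (λ j → (s ∸ toℕ j * k) ⊓ k) ≡ s ⊓ (n * k)
grid-count zero    k s = sym (⊓-zeroʳ s)
grid-count (suc n) k s = begin
  s ⊓ k + sumFin {n} (λ j → (s ∸ (k + toℕ j * k)) ⊓ k)
    ≡⟨ cong (s ⊓ k +_) (sumFin-cong {n} λ j → cong (_⊓ k) (sym (∸-+-assoc s k (toℕ j * k)))) ⟩
  s ⊓ k + sumFin {n} (λ j → (s ∸ k ∸ toℕ j * k) ⊓ k)
    ≡⟨ cong (s ⊓ k +_) (grid-count n k (s ∸ k)) ⟩
  s ⊓ k + (s ∸ k) ⊓ (n * k)
    ≡⟨ m⊓n+[m∸n]⊓o≡m⊓[n+o] s k (n * k) ⟩
  s ⊓ (k + n * k) ∎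
  where open ≡-Reasoning

staircaseT≡ : ∀ {k n} i j → staircaseT k n i j ≡ suc (toℕ i + toℕ j * k)
staircaseT≡ {k} i j = trans (+-comm (toℕ j * k + toℕ i) 1) (cong suc (+-comm (toℕ j * k) (toℕ i)))

rank-staircase : ∀ k n {s} → s ≤ n * k →
                 rank (ι ∘ toℕ {k}) (ι ∘ λ (j : Fin n) → toℕ j * k) (ι s) ≡ suc s
rank-staircase k n {s} s≤nk = cong suc (begin
  sumFin {k} (λ i → sumFin {n} (λ j → 𝟙[ ι (toℕ i) ℚ.+ ι (toℕ j * k) < ι s ]))
    ≡⟨ sumFin-cong {k} (λ i → sumFin-cong {n} λ j →
         cong (λ p → 𝟙[ p < ι s ]) (ι-+ (toℕ i) (toℕ j * k))) ⟩
  sumFin {k} (λ i → sumFin {n} (λ j → 𝟙[ ι (toℕ i + toℕ j * k) < ι s ]))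
    ≡⟨ sumFin-comm {k} {n} (λ i j → 𝟙[ ι (toℕ i + toℕ j * k) < ι s ]) ⟩
  sumFin {n} (λ j → sumFin {k} (λ i → 𝟙[ ι (toℕ i + toℕ j * k) < ι s ]))
    ≡⟨ sumFin-cong {n} (λ j → column-count k (toℕ j * k) s) ⟩
  sumFin {n} (λ j → (s ∸ toℕ j * k) ⊓ k)
    ≡⟨ grid-count n k s ⟩
  s ⊓ (n * k)
    ≡⟨ m≤n⇒m⊓n≡m s≤nk ⟩
  s ∎)
  where open ≡-Reasoning

staircase-realizable : ∀ k n .{{_ : NonZero k}} → Realizable k n (staircaseT k n)
staircase-realizable k n =
  realizable-ι (toℕ {k}) column (λ i<i' → i<i') (*-monoˡ-< k) sums-injective staircase≐𝒯
  where
  column : Fin n → ℕ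
  column j = toℕ j * k
  x : Fin k → ℚ
  x = ι ∘ toℕ
  y : Fin n → ℚ
  y = ι ∘ column
  sums-injective : ∀ i i' j j' → toℕ i + column j ≡ toℕ i' + column j' → (i , j) ≡ (i' , j')
  sums-injective i i' j j' t≡t' with +*-injective (Fin.toℕ<n i) (Fin.toℕ<n i') t≡t'
  ... | i≡i' , j≡j' = cong₂ _,_ (Fin.toℕ-injective i≡i') (Fin.toℕ-injective j≡j')
  staircase≐𝒯 : ∀ i j → staircaseT k n i j ≡ 𝒯 x y i j
  staircase≐𝒯 i j = begin
    staircaseT k n i j                ≡⟨ staircaseT≡ i j ⟩
    suc (toℕ i + column j)            ≡⟨ rank-staircase k n entry≤nk ⟨
    rank x y (ι (toℕ i + column j))   ≡⟨ cong (rank x y) (ι-+ (toℕ i) (column j)) ⟨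
    𝒯 x y i j                         ∎
    where
    open ≡-Reasoning
    entry≤nk : toℕ i + column j ≤ n * k
    entry≤nk = <⇒≤ (+*-mono-<ₗₑₓ (Fin.toℕ<n i) (inj₁ (Fin.toℕ<n j)))

staircase-<⇔ : ∀ {k n} i i' j j' →
               staircaseT k n i j < staircaseT k n i' j' ⇔ (toℕ j , toℕ i) <ₗₑₓ (toℕ j' , toℕ i')
staircase-<⇔ i i' j j' = mk⇔
  (λ T<T' → to (s≤s⁻¹ (subst₂ _<_ (staircaseT≡ i j) (staircaseT≡ i' j') T<T')))
  (λ ij<i'j' → subst₂ _<_ (sym (staircaseT≡ i j)) (sym (staircaseT≡ i' j')) (s≤s (from ij<i'j')))
  where open Equivalence (+*-<⇔<ₗₑₓ (Fin.toℕ<n i) (Fin.toℕ<n i'))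

-- Entry (i , j) is the sum toℕ i + level i j * (k + 1) with toℕ i ≤ k, so entries compare
-- lexicographically by (level , row): the first k rows order like the staircase, and the
-- added last row sits D levels above the first one.
module Extension (k n D : ℕ) (Y : Fin n → ℕ) (Y-mono : Y Preserves Fin._<_ ⟶ _<_) where

  lift : Fin (suc k) → ℕ
  lift i with view i
  ... | ‵fromℕ     = D
  ... | ‵inject₁ _ = 0

  lift-inject₁ : ∀ i → lift (inject₁ i) ≡ 0
  lift-inject₁ i rewrite view-inject₁ i = refl

  lift-fromℕ : lift (fromℕ k) ≡ D
  lift-fromℕ rewrite view-fromℕ k = refl

  lift-< : ∀ {i i' : Fin (suc k)} → i Fin.< i' → lift i ≡ 0
  lift-< {i} {i'} i<i' with view i
  ... | ‵fromℕ     = contradiction (subst (_< toℕ i') (Fin.toℕ-fromℕ k) i<i')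
                                   (≤⇒≯ (s≤s⁻¹ (Fin.toℕ<n {suc k} i')))
  ... | ‵inject₁ _ = refl

  q : ℕ
  q = suc k

  level : Fin (suc k) → Fin n → ℕ
  level i j = lift i + Y j

  row : Fin (suc k) → ℕ
  row i = toℕ i + lift i * q

  column : Fin n → ℕ
  column j = Y j * q

  tableau : Tableau (suc k) n
  tableau = 𝒯 (ι ∘ row) (ι ∘ column)

  row+column : ∀ i j → row i + column j ≡ toℕ i + level i j * q
  row+column i j =
    trans (+-assoc (toℕ i) _ _) (cong (toℕ i +_) (sym (*-distribʳ-+ q (lift i) (Y j))))

  tableau-<⇔ : ∀ i j i' j' →
               tableau i j < tableau i' j' ⇔ (level i j , toℕ i) <ₗₑₓ (level i' j' , toℕ i')
  tableau-<⇔ i j i' j' = begin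
    tableau i j < tableau i' j'
      ∼⟨ 𝒯-ι-<⇔ row column i j i' j' ⟩
    row i + column j < row i' + column j'
      ≡⟨ cong₂ _<_ (row+column i j) (row+column i' j') ⟩
    toℕ i + level i j * q < toℕ i' + level i' j' * q
      ∼⟨ +*-<⇔<ₗₑₓ {A = level i j} {level i' j'} (Fin.toℕ<n i) (Fin.toℕ<n i') ⟩
    (level i j , toℕ i) <ₗₑₓ (level i' j' , toℕ i')
      ∎
    where open EquationalReasoning

  realizable : Realizable (suc k) n tableau
  realizable = realizable-ι row column row-mono (*-monoˡ-< q ∘ Y-mono) sums-injective (λ _ _ → refl)
    where
    row-mono : row Preserves Fin._<_ ⟶ _<_
    row-mono {i} {i'} i<i' = begin-strict
      toℕ i + lift i * q  ≡⟨ cong (λ d → toℕ i + d * q) (lift-< i<i') ⟩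
      toℕ i + 0           ≡⟨ +-identityʳ (toℕ i) ⟩
      toℕ i               <⟨ i<i' ⟩
      toℕ i'              ≤⟨ m≤m+n (toℕ i') (lift i' * q) ⟩
      row i'              ∎
      where open ≤-Reasoning
    sums-injective : ∀ i i' j j' → row i + column j ≡ row i' + column j' → (i , j) ≡ (i' , j')
    sums-injective i i' j j' t≡t'
      with +*-injective {A = level i j} {level i' j'} (Fin.toℕ<n i) (Fin.toℕ<n i')
             (trans (sym (row+column i j)) (trans t≡t' (row+column i' j')))
    ... | i≡i' , level≡level' with Fin.toℕ-injective i≡i'
    ... | refl = cong (i ,_) (mono-injective Y-mono (+-cancelˡ-≡ (lift i) _ _ level≡level'))

  singleRowExtension : SingleRowExtension k n (staircaseT k n) tableau
  singleRowExtension = realizable , restricts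
    where
    restricts : ∀ i i' j j' →
                tableau (inject₁ i) j < tableau (inject₁ i') j' ⇔
                staircaseT k n i j < staircaseT k n i' j'
    restricts i i' j j' = begin
      tableau (inject₁ i) j < tableau (inject₁ i') j'
        ∼⟨ tableau-<⇔ (inject₁ i) j (inject₁ i') j' ⟩
      (level (inject₁ i) j , toℕ (inject₁ i)) <ₗₑₓ (level (inject₁ i') j' , toℕ (inject₁ i'))
        ≡⟨ cong₂ _<ₗₑₓ_ (cong₂ (λ d r → (d + Y j , r)) (lift-inject₁ i) (Fin.toℕ-inject₁ i))
                        (cong₂ (λ d r → (d + Y j' , r)) (lift-inject₁ i') (Fin.toℕ-inject₁ i')) ⟩
      (Y j , toℕ i) <ₗₑₓ (Y j' , toℕ i')
        ∼⟨ <ₗₑₓ-reindex Y-mono ⟩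
      (toℕ j , toℕ i) <ₗₑₓ (toℕ j' , toℕ i')
        ∼⟨ ⇔-sym (staircase-<⇔ i i' j j') ⟩
      staircaseT k n i j < staircaseT k n i' j'
        ∎
      where open EquationalReasoning

  top<bottom : ∀ {i l j} → Y l < D + Y j → tableau (inject₁ i) l < tableau (fromℕ k) j
  top<bottom {i} {l} {j} Yl<D+Yj = Equivalence.from (tableau-<⇔ (inject₁ i) l (fromℕ k) j)
    (inj₁ (subst₂ (λ d d' → d + Y l < d' + Y j) (sym (lift-inject₁ i)) (sym lift-fromℕ) Yl<D+Yj))

  bottom<top : ∀ {i l j} → D + Y j < Y l → tableau (fromℕ k) j < tableau (inject₁ i) l
  bottom<top {i} {l} {j} D+Yj<Yl = Equivalence.from (tableau-<⇔ (fromℕ k) j (inject₁ i) l)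
    (inj₁ (subst₂ (λ d d' → d + Y j < d' + Y l) (sym lift-fromℕ) (sym (lift-inject₁ i)) D+Yj<Yl))

-- Ballot sequences

extend : ℕ → (ℕ → ℕ) → ℕ → ℕ → ℕ
extend n f v l with l <? n
... | yes _ = f l
... | no  _ = v

extend-< : ∀ {n} f {v l} → l < n → extend n f v l ≡ f l
extend-< {n} f {l = l} l<n with l <? n
... | yes _   = refl
... | no  l≮n = contradiction l<n l≮n

extend-≡ : ∀ n f {v} → extend n f v n ≡ v
extend-≡ n f with n <? n
... | yes n<n = contradiction n<n (<-irrefl refl)
... | no  _   = refl

AgreeBelow : ℕ → (ℕ → ℕ) → (ℕ → ℕ) → Set
AgreeBelow n f g = ∀ l → l < n → f l ≡ g l

AgreeBelow-extend⁻ : ∀ {n f f' v v'} →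
                     AgreeBelow (suc n) (extend n f v) (extend n f' v') → AgreeBelow n f f'
AgreeBelow-extend⁻ {f = f} {f'} agree l l<n =
  trans (sym (extend-< f l<n)) (trans (agree l (m<n⇒m<1+n l<n)) (extend-< f' l<n))

-- Ballot n b: the sequences g 0 ≤ g 1 ≤ … ≤ g (n - 1) with g l ≤ l and all entries ≤ b;
-- snoc appends the entry a, which bounds the sequence it extends.
data Ballot : ℕ → ℕ → Set where
  []   : ∀ {b} → Ballot 0 b
  snoc : ∀ {n a b} → Ballot n a → a ≤ b → a ≤ n → Ballot (suc n) b

value : ∀ {n b} → Ballot n b → ℕ → ℕ
value []                   = λ _ → 0
value (snoc {n} {a} β _ _) = extend n (value β) a

value≤index : ∀ {n b l} (β : Ballot n b) → l < n → value β l ≤ l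
value≤index {l = l} (snoc {n} β _ a≤n) l<1+n with m<1+n⇒m<n∨m≡n l<1+n
... | inj₁ l<n  = ≤-trans (≤-reflexive (extend-< (value β) l<n)) (value≤index β l<n)
... | inj₂ refl = ≤-trans (≤-reflexive (extend-≡ n (value β))) a≤n

value≤bound : ∀ {n b l} (β : Ballot n b) → l < n → value β l ≤ b
value≤bound {l = l} (snoc {n} β a≤b _) l<1+n with m<1+n⇒m<n∨m≡n l<1+n
... | inj₁ l<n  = ≤-trans (≤-reflexive (extend-< (value β) l<n)) (≤-trans (value≤bound β l<n) a≤b)
... | inj₂ refl = ≤-trans (≤-reflexive (extend-≡ n (value β))) a≤b

weaken : ∀ {n b b'} → b ≤ b' → Ballot n b → Ballot n b'
weaken _    []               = []
weaken b≤b' (snoc β a≤b a≤n) = snoc β (≤-trans a≤b b≤b') a≤n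

value-weaken : ∀ {n b b'} (b≤b' : b ≤ b') (β : Ballot n b) l → value (weaken b≤b' β) l ≡ value β l
value-weaken _ []           _ = refl
value-weaken _ (snoc _ _ _) _ = refl

AgreeBelow-weaken⁻ : ∀ {n b b' c c'} {p : b ≤ c} {p' : b' ≤ c'}
                     (β : Ballot n b) (β' : Ballot n b') →
                     AgreeBelow n (value (weaken p β)) (value (weaken p' β')) →
                     AgreeBelow n (value β) (value β')
AgreeBelow-weaken⁻ {p = p} {p'} β β' agree l l<n =
  trans (sym (value-weaken p β l)) (trans (agree l l<n) (value-weaken p' β' l))

-- Y l is the level of column l in the old rows and D + Y j that of column j in the added
-- row; the added-row entries smaller than those of column l are those of the columns j < g l.
record Interleaving (n : ℕ) (g : ℕ → ℕ) (D : ℕ) (Y : ℕ → ℕ) : Set where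
  field
    increasing  : ∀ {l l'} → l < l' → l' < n → Y l < Y l'
    below-shift : ∀ {l} → l < n → Y l < D + Y (g l)
    above-shift : ∀ {l j} → l < n → j < g l → D + Y j < Y l

  increasing-≤ : ∀ {l l'} → l ≤ l' → l' < n → Y l ≤ Y l'
  increasing-≤ l≤l' l'<n with m≤n⇒m<n∨m≡n l≤l'
  ... | inj₁ l<l' = <⇒≤ (increasing l<l' l'<n)
  ... | inj₂ refl = ≤-refl

shiftedPred : ℕ → (ℕ → ℕ) → ℕ → ℕ
shiftedPred D Y zero    = 0
shiftedPred D Y (suc m) = D + Y m

-- Levels are doubled to make room; the new column gets the odd level just above both the
-- last column and the shifted column a - 1, which is still below the shifted column a.
newLevel : ℕ → (ℕ → ℕ) → ℕ → ℕ → ℕ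
newLevel D Y n a = suc (2 * (Y (pred n) ⊔ shiftedPred D Y a))

1+2*m<2*n : ∀ {m n} → m < n → suc (2 * m) < 2 * n
1+2*m<2*n {m} {n} m<n = subst (_≤ 2 * n) (cong suc (+-suc m (m + 0))) (*-monoʳ-≤ 2 m<n)

pred<self : ∀ {l n} → l < n → pred n < n
pred<self {n = suc n} _ = ≤-refl

module InterleavingSnoc {n g D Y a} (I : Interleaving n g D Y) (D>0 : 0 < D)
       (g≤id : ∀ {l} → l < n → g l ≤ l) (g≤a : ∀ {l} → l < n → g l ≤ a) (a≤n : a ≤ n) where

  open Interleaving I
  open ≤-Reasoning

  new : ℕ
  new = newLevel D Y n a

  g' Y' : ℕ → ℕ
  g' = extend n g a
  Y' = extend n (λ l → 2 * Y l) new

  old<new : ∀ {l} → l < n → 2 * Y l < new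
  old<new {l} l<n = s≤s (begin
    2 * Y l                               ≤⟨ *-monoʳ-≤ 2 (increasing-≤ l≤n-1 (pred<self l<n)) ⟩
    2 * Y (pred n)                        ≤⟨ *-monoʳ-≤ 2 (m≤m⊔n (Y (pred n)) (shiftedPred D Y a)) ⟩
    2 * (Y (pred n) ⊔ shiftedPred D Y a)  ∎)
    where
    l≤n-1 : l ≤ pred n
    l≤n-1 = <⇒≤pred l<n

  shiftedPred<new : 2 * shiftedPred D Y a < new
  shiftedPred<new = s≤s (*-monoʳ-≤ 2 (m≤n⊔m (Y (pred n)) (shiftedPred D Y a)))

  shiftedPred<shifted : ∀ a' → a' < n → shiftedPred D Y a' < D + Y a'
  shiftedPred<shifted zero    _     = ≤-trans D>0 (m≤m+n D (Y 0))
  shiftedPred<shifted (suc m) 1+m<n = +-monoʳ-< D (increasing ≤-refl 1+m<n)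

  shifted≤shiftedPred : ∀ {j} a' → j < a' → a' ≤ n → D + Y j ≤ shiftedPred D Y a'
  shifted≤shiftedPred (suc m) j<1+m 1+m≤n = +-monoʳ-≤ D (increasing-≤ (s≤s⁻¹ j<1+m) 1+m≤n)

  new<shifted : a < n → new < 2 * (D + Y a)
  new<shifted a<n = 1+2*m<2*n (⊔-lub last<shifted (shiftedPred<shifted a a<n))
    where
    last<shifted : Y (pred n) < D + Y a
    last<shifted = <-≤-trans (below-shift (pred<self a<n))
                             (+-monoʳ-≤ D (increasing-≤ (g≤a (pred<self a<n)) a<n))

  increasing' : ∀ {l l'} → l < l' → l' < suc n → Y' l < Y' l'
  increasing' {l} {l'} l<l' l'<1+n with m<1+n⇒m<n∨m≡n l'<1+n
  ... | inj₁ l'<n = begin-strict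
    Y' l      ≡⟨ extend-< _ (<-trans l<l' l'<n) ⟩
    2 * Y l   <⟨ *-monoʳ-< 2 (increasing l<l' l'<n) ⟩
    2 * Y l'  ≡⟨ extend-< _ l'<n ⟨
    Y' l'     ∎
  ... | inj₂ refl = begin-strict
    Y' l      ≡⟨ extend-< _ l<l' ⟩
    2 * Y l   <⟨ old<new l<l' ⟩
    new       ≡⟨ extend-≡ n _ ⟨
    Y' n      ∎

  below' : ∀ {l} → l < suc n → Y' l < 2 * D + Y' (g' l)
  below' {l} l<1+n with m<1+n⇒m<n∨m≡n l<1+n
  ... | inj₁ l<n = begin-strict
    Y' l                 ≡⟨ extend-< _ l<n ⟩
    2 * Y l              <⟨ *-monoʳ-< 2 (below-shift l<n) ⟩
    2 * (D + Y (g l))    ≡⟨ *-distribˡ-+ 2 D (Y (g l)) ⟩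
    2 * D + 2 * Y (g l)  ≡⟨ cong (2 * D +_) (extend-< _ (≤-<-trans (g≤id l<n) l<n)) ⟨
    2 * D + Y' (g l)     ≡⟨ cong (λ m → 2 * D + Y' m) (extend-< g l<n) ⟨
    2 * D + Y' (g' l)    ∎
  ... | inj₂ refl with m≤n⇒m<n∨m≡n a≤n
  ...   | inj₁ a<n = begin-strict
    Y' n               ≡⟨ extend-≡ n _ ⟩
    new                <⟨ new<shifted a<n ⟩
    2 * (D + Y a)      ≡⟨ *-distribˡ-+ 2 D (Y a) ⟩
    2 * D + 2 * Y a    ≡⟨ cong (2 * D +_) (extend-< _ a<n) ⟨
    2 * D + Y' a       ≡⟨ cong (λ m → 2 * D + Y' m) (extend-≡ n g) ⟨
    2 * D + Y' (g' n)  ∎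
  ...   | inj₂ refl = begin-strict
    Y' n               <⟨ m<n+m (Y' n) (*-monoʳ-< 2 D>0) ⟩
    2 * D + Y' n       ≡⟨ cong (λ m → 2 * D + Y' m) (extend-≡ n g) ⟨
    2 * D + Y' (g' n)  ∎

  above' : ∀ {l j} → l < suc n → j < g' l → 2 * D + Y' j < Y' l
  above' {l} {j} l<1+n j<g'l with m<1+n⇒m<n∨m≡n l<1+n
  ... | inj₁ l<n = begin-strict
    2 * D + Y' j     ≡⟨ cong (2 * D +_) (extend-< _ j<n) ⟩
    2 * D + 2 * Y j  ≡⟨ *-distribˡ-+ 2 D (Y j) ⟨
    2 * (D + Y j)    <⟨ *-monoʳ-< 2 (above-shift l<n j<gl) ⟩
    2 * Y l          ≡⟨ extend-< _ l<n ⟨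
    Y' l             ∎
    where
    j<gl : j < g l
    j<gl = subst (j <_) (extend-< g l<n) j<g'l
    j<n : j < n
    j<n = <-trans (<-≤-trans j<gl (g≤id l<n)) l<n
  ... | inj₂ refl = begin-strict
    2 * D + Y' j           ≡⟨ cong (2 * D +_) (extend-< _ (<-≤-trans j<a a≤n)) ⟩
    2 * D + 2 * Y j        ≡⟨ *-distribˡ-+ 2 D (Y j) ⟨
    2 * (D + Y j)          ≤⟨ *-monoʳ-≤ 2 (shifted≤shiftedPred a j<a a≤n) ⟩
    2 * shiftedPred D Y a  <⟨ shiftedPred<new ⟩
    new                    ≡⟨ extend-≡ n _ ⟨
    Y' n                   ∎
    where
    j<a : j < a
    j<a = subst (j <_) (extend-≡ n g) j<g'l

  interleaving : Interleaving (suc n) g' (2 * D) Y'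
  interleaving = record { increasing = increasing' ; below-shift = below' ; above-shift = above' }

levels : ∀ {n b} → Ballot n b → ℕ → ℕ
levels []                   = λ _ → 0
levels (snoc {n} {a} β _ _) = extend n (λ l → 2 * levels β l) (newLevel (2 ^ n) (levels β) n a)

ballot-interleaving : ∀ {n b} (β : Ballot n b) → Interleaving n (value β) (2 ^ n) (levels β)
ballot-interleaving [] =
  record { increasing = λ _ () ; below-shift = λ () ; above-shift = λ () }
ballot-interleaving (snoc {n} β a≤b a≤n) = InterleavingSnoc.interleaving
  (ballot-interleaving β) (m^n>0 2 n) (value≤index β) (value≤bound β) a≤n

module BallotExtension (k : ℕ) {n b} (β : Ballot n b) where

  open Interleaving (ballot-interleaving β)

  levelsFin : Fin n → ℕ
  levelsFin j = levels β (toℕ j)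

  levelsFin-mono : levelsFin Preserves Fin._<_ ⟶ _<_
  levelsFin-mono {i} {j} i<j = increasing i<j (Fin.toℕ<n j)

  open Extension (suc k) n (2 ^ n) levelsFin levelsFin-mono public
    using (tableau; singleRowExtension)
  open Extension (suc k) n (2 ^ n) levelsFin levelsFin-mono
    using (top<bottom; bottom<top)

  levelsFin-fromℕ< : ∀ {l} (l<n : l < n) → levelsFin (fromℕ< l<n) ≡ levels β l
  levelsFin-fromℕ< l<n = cong (levels β) (Fin.toℕ-fromℕ< l<n)

  value≤⇒top<bottom : ∀ {l j} (l<n : l < n) (j<n : j < n) → value β l ≤ j →
                      tableau (inject₁ Fin.zero) (fromℕ< l<n) < tableau (fromℕ (suc k)) (fromℕ< j<n)
  value≤⇒top<bottom l<n j<n gl≤j = top<bottom {Fin.zero} {fromℕ< l<n} {fromℕ< j<n}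
    (subst₂ (λ h h' → h < 2 ^ n + h') (sym (levelsFin-fromℕ< l<n)) (sym (levelsFin-fromℕ< j<n))
      (<-≤-trans (below-shift l<n) (+-monoʳ-≤ (2 ^ n) (increasing-≤ gl≤j j<n))))

  <value⇒bottom<top : ∀ {l j} (l<n : l < n) (j<n : j < n) → j < value β l →
                      tableau (fromℕ (suc k)) (fromℕ< j<n) < tableau (inject₁ Fin.zero) (fromℕ< l<n)
  <value⇒bottom<top l<n j<n j<gl = bottom<top {Fin.zero} {fromℕ< l<n} {fromℕ< j<n}
    (subst₂ (λ h h' → 2 ^ n + h' < h) (sym (levelsFin-fromℕ< l<n)) (sym (levelsFin-fromℕ< j<n))
      (above-shift l<n j<gl))

≐⇒value≤ : ∀ k {n b b'} (β : Ballot n b) (β' : Ballot n b') →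
           BallotExtension.tableau k β ≐ BallotExtension.tableau k β' →
           ∀ {l} → l < n → value β l ≤ value β' l
≐⇒value≤ k {n} β β' T≐T' {l} l<n = ≮⇒≥ λ g'l<gl → <-asym
  (subst₂ _<_ (T≐T' (fromℕ (suc k)) (fromℕ< j<n)) (T≐T' (inject₁ Fin.zero) (fromℕ< l<n))
    (BallotExtension.<value⇒bottom<top k β l<n j<n g'l<gl))
  (BallotExtension.value≤⇒top<bottom k β' l<n j<n ≤-refl)
  where
  j<n : value β' l < n
  j<n = ≤-<-trans (value≤index β' l<n) l<n

≐⇒AgreeBelow : ∀ k {n b b'} (β : Ballot n b) (β' : Ballot n b') →
               BallotExtension.tableau k β ≐ BallotExtension.tableau k β' →
               AgreeBelow n (value β) (value β')
≐⇒AgreeBelow k β β' T≐T' l l<n =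
  ≤-antisym (≐⇒value≤ k β β' T≐T' l<n) (≐⇒value≤ k β' β (λ i j → sym (T≐T' i j)) l<n)

-- Counting ballot sequences

ballots : ℕ → ℕ → ℕ
ballots zero    b       = 1
ballots (suc n) zero    = ballots n zero
ballots (suc n) (suc b) with suc b ≤? n
... | yes _ = ballots (suc n) b + ballots n (suc b)
... | no  _ = ballots (suc n) b

decode : ∀ n b → Fin (ballots n b) → Ballot n b
decode zero    b       _ = []
decode (suc n) zero    i = snoc (decode n zero i) z≤n z≤n
decode (suc n) (suc b) i with suc b ≤? n
... | yes 1+b≤n =
  (weaken (n≤1+n b) ∘ decode (suc n) b ++ λ j → snoc (decode n (suc b) j) ≤-refl 1+b≤n) i
... | no  _     = weaken (n≤1+n b) (decode (suc n) b i)

++-injective : ∀ {a ℓ} {A : Set a} {m n} (_≈_ : Rel A ℓ) {f : Fin m → A} {g : Fin n → A} →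
               (∀ {i i'} → f i ≈ f i' → i ≡ i') → (∀ {j j'} → g j ≈ g j' → j ≡ j') →
               (∀ {i j} → ¬ f i ≈ g j) → (∀ {i j} → ¬ g j ≈ f i) →
               ∀ {k k'} → (f ++ g) k ≈ (f ++ g) k' → k ≡ k'
++-injective {m = m} {n} _≈_ {f} {g} f-injective g-injective f≉g g≉f {k} {k'} fgk≈fgk' = begin
  k                   ≡⟨ Fin.join-splitAt m n k ⟨
  Fin.join m n s      ≡⟨ cong (Fin.join m n) (copair-injective s s' fgk≈fgk') ⟩
  Fin.join m n s'     ≡⟨ Fin.join-splitAt m n k' ⟩
  k'                  ∎
  where
  open ≡-Reasoning
  s s' : Fin m ⊎ Fin n
  s  = splitAt m k
  s' = splitAt m k'
  copair-injective : ∀ t t' → [ f , g ]′ t ≈ [ f , g ]′ t' → t ≡ t'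
  copair-injective (inj₁ i) (inj₁ i') fi≈fi' = cong inj₁ (f-injective fi≈fi')
  copair-injective (inj₁ i) (inj₂ j') fi≈gj' = contradiction fi≈gj' f≉g
  copair-injective (inj₂ j) (inj₁ i') gj≈fi' = contradiction gj≈fi' g≉f
  copair-injective (inj₂ j) (inj₂ j') gj≈gj' = cong inj₂ (g-injective gj≈gj')

decode-injective : ∀ n b {i i'} →
                   AgreeBelow n (value (decode n b i)) (value (decode n b i')) → i ≡ i'
decode-injective zero    b {Fin.zero} {Fin.zero} _ = refl
decode-injective (suc n) zero agree = decode-injective n zero (AgreeBelow-extend⁻ agree)
decode-injective (suc n) (suc b) agree with suc b ≤? n
... | no  _     =
  decode-injective (suc n) b (AgreeBelow-weaken⁻ (decode (suc n) b _) (decode (suc n) b _) agree)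
... | yes 1+b≤n = ++-injective _≈_ {f = lower} {upper}
  (λ {i i'} → decode-injective (suc n) b ∘ AgreeBelow-weaken⁻ (lower' i) (lower' i'))
  (decode-injective n (suc b) ∘ AgreeBelow-extend⁻)
  lower≉upper (λ upper≈lower → lower≉upper (λ l l<1+n → sym (upper≈lower l l<1+n))) agree
  where
  _≈_ : Ballot (suc n) (suc b) → Ballot (suc n) (suc b) → Set
  β ≈ β' = AgreeBelow (suc n) (value β) (value β')
  lower' : Fin (ballots (suc n) b) → Ballot (suc n) b
  lower' = decode (suc n) b
  lower : Fin (ballots (suc n) b) → Ballot (suc n) (suc b)
  lower = weaken (n≤1+n b) ∘ lower'
  upper : Fin (ballots n (suc b)) → Ballot (suc n) (suc b)
  upper j = snoc (decode n (suc b) j) ≤-refl 1+b≤n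
  lower≉upper : ∀ {i j} → ¬ lower i ≈ upper j
  lower≉upper {i} {j} agree = <-irrefl refl (begin-strict
    b                             <⟨ n<1+n b ⟩
    suc b                         ≡⟨ extend-≡ n (value (decode n (suc b) j)) ⟨
    value (upper j) n             ≡⟨ agree n (n<1+n n) ⟨
    value (lower i) n             ≡⟨ value-weaken (n≤1+n b) (decode (suc n) b i) n ⟩
    value (decode (suc n) b i) n  ≤⟨ value≤bound (decode (suc n) b i) (n<1+n n) ⟩
    b                             ∎)
    where open ≤-Reasoning

-- m C (b - 1), except that it is 0 (not m C 0) for b = 0.
C-prev : ℕ → ℕ → ℕ
C-prev m zero    = 0
C-prev m (suc b) = m C b

pascal-C-prev : ∀ m b → suc m C b ≡ C-prev m b + m C b
pascal-C-prev m zero    = refl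
pascal-C-prev m (suc b) = sym (nCk+nC[k+1]≡[n+1]C[k+1] m b)

ballots+C-prev≡C : ∀ n b → b ≤ n → ballots n b + C-prev (n + b) b ≡ (n + b) C b
ballots+C-prev≡C zero    zero    _       = refl
ballots+C-prev≡C (suc n) zero    _       = ballots+C-prev≡C n zero z≤n
ballots+C-prev≡C (suc n) (suc b) 1+b≤1+n with suc b ≤? n
... | yes 1+b≤n = begin
  ballots (suc n) b + ballots n (suc b) + suc m C b
    ≡⟨ cong (ballots (suc n) b + ballots n (suc b) +_) (pascal-C-prev m b) ⟩
  ballots (suc n) b + ballots n (suc b) + (C-prev m b + m C b)
    ≡⟨ +-interchange (ballots (suc n) b) (ballots n (suc b)) (C-prev m b) (m C b) ⟩
  (ballots (suc n) b + C-prev m b) + (ballots n (suc b) + m C b)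
    ≡⟨ cong₂ _+_ lower-part (ballots+C-prev≡C n (suc b) 1+b≤n) ⟩
  m C b + m C suc b
    ≡⟨ nCk+nC[k+1]≡[n+1]C[k+1] m b ⟩
  suc m C suc b ∎
  where
  open ≡-Reasoning
  m = n + suc b
  lower-part : ballots (suc n) b + C-prev m b ≡ m C b
  lower-part rewrite +-suc n b = ballots+C-prev≡C (suc n) b (<⇒≤ 1+b≤1+n)
... | no  1+b≰n with ≤-antisym (s≤s⁻¹ 1+b≤1+n) (≮⇒≥ 1+b≰n)
...   | refl = begin
  ballots (suc b) b + suc m C b
    ≡⟨ cong (ballots (suc b) b +_) (pascal-C-prev m b) ⟩
  ballots (suc b) b + (C-prev m b + m C b)
    ≡⟨ +-assoc (ballots (suc b) b) (C-prev m b) (m C b) ⟨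
  ballots (suc b) b + C-prev m b + m C b
    ≡⟨ cong (_+ m C b) lower-part ⟩
  m C b + m C b
    ≡⟨ cong (m C b +_) middle-symmetry ⟩
  m C b + m C suc b
    ≡⟨ nCk+nC[k+1]≡[n+1]C[k+1] m b ⟩
  suc m C suc b ∎
  where
  open ≡-Reasoning
  m = b + suc b
  lower-part : ballots (suc b) b + C-prev m b ≡ m C b
  lower-part rewrite +-suc b b = ballots+C-prev≡C (suc b) b (n≤1+n b)
  middle-symmetry : m C b ≡ m C suc b
  middle-symmetry = begin
    m C b            ≡⟨ cong (m C_) (m+n∸n≡m b (suc b)) ⟨
    m C (m ∸ suc b)  ≡⟨ nCk≡nC[n∸k] (m≤n+m (suc b) b) ⟨
    m C suc b        ∎

nCk*k!*[n∸k]!≡n! : ∀ {n k} → k ≤ n → (n C k) * (k ! * (n ∸ k) !) ≡ n !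
nCk*k!*[n∸k]!≡n! {n} {k} k≤n =
  trans (cong (_* (k ! * (n ∸ k) !)) (nCk≡n!/k![n-k]! k≤n)) (m/n*n≡m (k![n∸k]!∣n! k≤n))
  where instance _ = k !* (n ∸ k) !≢0

[k+1]*nC[k+1]≡[n∸k]*nCk : ∀ {n k} → k < n → suc k * (n C suc k) ≡ (n ∸ k) * (n C k)
[k+1]*nC[k+1]≡[n∸k]*nCk {n} {k} k<n = *-cancelʳ-≡ _ _ d[k] (begin
  suc k * (n C suc k) * d[k]        ≡⟨ *-assoc (suc k) (n C suc k) d[k] ⟩
  suc k * ((n C suc k) * d[k])      ≡⟨ x∙yz≈y∙xz (suc k) (n C suc k) d[k] ⟩
  (n C suc k) * (suc k * d[k])      ≡⟨ cong ((n C suc k) *_) ([n-k]*d[k+1]≡[k+1]*d[k] k<n) ⟨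
  (n C suc k) * ((n ∸ k) * d[k+1])  ≡⟨ x∙yz≈y∙xz (n C suc k) (n ∸ k) d[k+1] ⟩
  (n ∸ k) * ((n C suc k) * d[k+1])  ≡⟨ cong ((n ∸ k) *_) (nCk*k!*[n∸k]!≡n! k<n) ⟩
  (n ∸ k) * n !                     ≡⟨ cong ((n ∸ k) *_) (nCk*k!*[n∸k]!≡n! (<⇒≤ k<n)) ⟨
  (n ∸ k) * ((n C k) * d[k])        ≡⟨ *-assoc (n ∸ k) (n C k) d[k] ⟨
  (n ∸ k) * (n C k) * d[k]          ∎)
  where
  open ≡-Reasoning
  d[k] d[k+1] : ℕ
  d[k]   = k ! * (n ∸ k) !
  d[k+1] = suc k ! * (n ∸ suc k) !
  instance _ = k !* (n ∸ k) !≢0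

[n+1]*C-prev≡n*C : ∀ n → suc n * C-prev (n + n) n ≡ n * ((n + n) C n)
[n+1]*C-prev≡n*C zero    = refl
[n+1]*C-prev≡n*C (suc n) = begin
  suc (suc n) * (m C n)   ≡⟨ cong (_* (m C n)) m∸n≡2+n ⟨
  (m ∸ n) * (m C n)       ≡⟨ [k+1]*nC[k+1]≡[n∸k]*nCk n<m ⟨
  suc n * (m C suc n)     ∎
  where
  open ≡-Reasoning
  m = suc n + suc n
  n<m : n < m
  n<m = s≤s (m≤m+n n (suc n))
  m∸n≡2+n : m ∸ n ≡ suc (suc n)
  m∸n≡2+n = trans (cong (λ o → suc o ∸ n) (+-suc n n)) (m+n∸n≡m (suc (suc n)) n)

catalan≡ballots : ∀ n → catalan n ≡ ballots n n
catalan≡ballots n = begin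
  ((2 * n) C n) / suc n          ≡⟨ cong (λ m → ((n + m) C n) / suc n) (+-identityʳ n) ⟩
  ((n + n) C n) / suc n          ≡⟨ cong (_/ suc n) ballots*[n+1]≡C ⟨
  ballots n n * suc n / suc n    ≡⟨ m*n/n≡m (ballots n n) (suc n) ⟩
  ballots n n                    ∎
  where
  open ≡-Reasoning
  B P : ℕ
  B = ballots n n
  P = C-prev (n + n) n
  ballots*[n+1]≡C : B * suc n ≡ (n + n) C n
  ballots*[n+1]≡C = +-cancelʳ-≡ (n * ((n + n) C n)) _ _ (begin
    B * suc n + n * ((n + n) C n)  ≡⟨ cong (B * suc n +_) ([n+1]*C-prev≡n*C n) ⟨
    B * suc n + suc n * P          ≡⟨ cong (_+ suc n * P) (*-comm B (suc n)) ⟩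
    suc n * B + suc n * P          ≡⟨ *-distribˡ-+ (suc n) B P ⟨
    suc n * (B + P)                ≡⟨ cong (suc n *_) (ballots+C-prev≡C n n ≤-refl) ⟩
    suc n * ((n + n) C n)          ∎)

proposition2p11 : ∀ (k n : ℕ) → 1 ≤ k → 1 ≤ n →
    Realizable k n (staircaseT k n) ×
    Σ (Fin (catalan n) → Tableau (suc k) n) λ E →
      (∀ c → SingleRowExtension k n (staircaseT k n) (E c)) ×
      (∀ c c' → E c ≐ E c' → c ≡ c')
proposition2p11 (suc k) n _ _ =
  staircase-realizable (suc k) n , E , extension , E-injective
  where
  eq : catalan n ≡ ballots n n
  eq = catalan≡ballots n
  ballot : Fin (catalan n) → Ballot n n
  ballot c = decode n n (Fin.cast eq c)
  E : Fin (catalan n) → Tableau (suc (suc k)) n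
  E c = BallotExtension.tableau k (ballot c)
  extension : ∀ c → SingleRowExtension (suc k) n (staircaseT (suc k) n) (E c)
  extension c = BallotExtension.singleRowExtension k (ballot c)
  E-injective : ∀ c c' → E c ≐ E c' → c ≡ c'
  E-injective c c' Ec≐Ec' = begin
    c                                   ≡⟨ Fin.cast-involutive (sym eq) eq c ⟨
    Fin.cast (sym eq) (Fin.cast eq c)   ≡⟨ cong (Fin.cast (sym eq)) cast-c≡cast-c' ⟩
    Fin.cast (sym eq) (Fin.cast eq c')  ≡⟨ Fin.cast-involutive (sym eq) eq c' ⟩
    c'                                  ∎
    where
    open ≡-Reasoning
    cast-c≡cast-c' : Fin.cast eq c ≡ Fin.cast eq c'
    cast-c≡cast-c' = decode-injective n n (≐⇒AgreeBelow k (ballot c) (ballot c') Ec≐Ec')
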